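{- Let $G$ be a graph, let $L$, $G'$ and $Z$ be constructed from $G$ as described in the context, and let $\gamma$ be any $L$-coloring of $G'$. Let $uv\in E(G)$ (with its chosen orientation $(u,v)$). If $\gamma(u)=\gamma(v)$, then $\gamma(z_{uv})=4$. If $\gamma(u)\neq\gamma(v)$, then there exists an $L$-recoloring sequence of length at most $C$ (for an absolute constant $C$ independent of $G$ and $\gamma$) from $\gamma$ to an $L$-coloring $\gamma'$ with $\gamma'(z_{uv})\neq 4$ and $\gamma'(w)=\gamma(w)$ for all $w\in (V(G)\cup Z)\setminus\{z_{uv}\}$.
   Context: Write $[4]=\{1,2,3,4\}$. For a graph $H$ and list assignment $L$ with $L(x)\subseteq[4]$, an $L$-coloring is a proper coloring $\gamma$ with $\gamma(x)\in L(x)$ for all $x$; an $L$-recoloring sequence of length $m$ is a sequence of $L$-colorings $\gamma_0,\dots,\gamma_m$ where consecutive colorings are equal or differ on exactly one vertex. For $r,s\in[4]$, a path $P$ with end vertices $p,q$ and lists $L(x)\subseteq[4]$ on its vertices is an $(r,s)$-forbidding path from $p$ to $q$ if: (i) for all $x\in L(p)$, $y\in L(q)$, there is an $L$-coloring $\gamma$ of $P$ with $\gamma(p)=x,\gamma(q)=y$ iff $x\ne r$ or $y\ne s$ (such $(x,y)$ is called admissible); (ii) for any $L$-coloring $\gamma$ of $P$ and any admissible pair $(x,y)$ with $x=\gamma(p)$ or $y=\gamma(q)$, there is an $L$-recoloring sequence of $P$ from $\gamma$ to an $L$-coloring $\delta$ with $\delta(p)=x,\delta(q)=y$ in which every internal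 vertex is recolored at most once and $p,q$ are not recolored until the last step. (Such paths of length six exist whenever $r\in L(p)\ne[4]$ and $s\in L(q)\ne[4]$.) Construction from a graph $G$ (each edge given an arbitrary orientation $(u,v)$): each $u\in V(G)$ is a vertex of $G'$ with $L(u)=\{1,2,3\}$. For each edge $uv\in E(G)$ add vertices $x_{uv},y_{uv},z_{uv}$ with $L(x_{uv})=\{1,2,4\}$, $L(y_{uv})=\{3,4\}$, $L(z_{uv})=\{1,2,4\}$; add edges $ux_{uv}$, $uy_{uv}$; and add, each with new internal vertices, an $(r,s)$-forbidding path of length six (internal lists $\subseteq[4]$) for each of: $(1,2)$ from $u$ to $x_{uv}$; $(3,1)$ from $u$ to $x_{uv}$; $(2,3)$ from $u$ to $y_{uv}$; $(2,1)$ from $v$ to $x_{uv}$; $(3,2)$ from $v$ to $x_{uv}$; $(1,3)$ from $v$ to $y_{uv}$; $(4,1)$ from $x_{uv}$ to $z_{uv}$; $(4,2)$ from $y_{uv}$ to $z_{uv}$. Let $Z=\{z_{uv}\mid uv\in E(G)\}$. Add vertices $a,b,c,d$ with $L(a)=\{1,2,3\}$, $L(b)=\{1,2\}$, $L(c)=\{3,4\}$, $L(d)=\{4\}$, all edges among them except $cd$, and edges from every vertex of $Z$ to $c$. No other edges. -}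

module Defs where

open import Data.Nat using (ℕ; zero; suc; _≤_; _<_)
open import Data.Fin using (Fin; zero; suc; toℕ; inject₁)
open import Data.Bool using (Bool; true; false; T)
open import Data.Product using (Σ; ∃; _×_; _,_; proj₁; proj₂; swap)
open import Data.Sum using (_⊎_)
open import Relation.Binary.PropositionalEquality using (_≡_; _≢_)

data Colour : Set where
  c1 c2 c3 c4 : Colour

ColList : Set
ColList = Colour → Bool

_∈L_ : Colour → ColList → Set
c ∈L S = T (S c)

IsLColoring : {V : Set} → (V → V → Set) → (V → ColList) → (V → Colour) → Set
IsLColoring {V} Adj L γ =
  ((v : V) → γ v ∈L L v) × ((u v : V) → Adj u v → γ u ≢ γ v)

AtMostOneDiff : {V : Set} → (V → Colour) → (V → Colour) → Set
AtMostOneDiff {V} γ δ = Σ V λ v → (w : V) → w ≢ v → γ w ≡ δ w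

IsRecolSeq : {V : Set} → (V → V → Set) → (V → ColList) →
             ℕ → (ℕ → V → Colour) → Set
IsRecolSeq Adj L len σ =
  ((i : ℕ) → i ≤ len → IsLColoring Adj L (σ i)) ×
  ((i : ℕ) → i < len → AtMostOneDiff (σ i) (σ (suc i)))

PathAdj : Fin 7 → Fin 7 → Set
PathAdj i j = (toℕ j ≡ suc (toℕ i)) ⊎ (toℕ i ≡ suc (toℕ j))

pEnd qEnd : Fin 7
pEnd = zero
qEnd = suc (suc (suc (suc (suc (suc zero)))))

Internal : Fin 7 → Set
Internal j = (0 < toℕ j) × (toℕ j < 6)

IsForbidding : Colour → Colour → (Fin 7 → ColList) → Set
IsForbidding r s P =
  ((x y : Colour) → x ∈L P pEnd → y ∈L P qEnd →
     ((Σ (Fin 7 → Colour) λ γ → IsLColoring PathAdj P γ × γ pEnd ≡ x × γ qEnd ≡ y)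
        → (x ≢ r ⊎ y ≢ s))
   × ((x ≢ r ⊎ y ≢ s)
        → Σ (Fin 7 → Colour) λ γ → IsLColoring PathAdj P γ × γ pEnd ≡ x × γ qEnd ≡ y))
  ×
  ((γ : Fin 7 → Colour) → IsLColoring PathAdj P γ →
   (x y : Colour) → x ∈L P pEnd → y ∈L P qEnd → (x ≢ r ⊎ y ≢ s) →
   (x ≡ γ pEnd ⊎ y ≡ γ qEnd) →
   Σ ℕ λ len → Σ (ℕ → Fin 7 → Colour) λ σ →
     IsRecolSeq PathAdj P len σ
     × ((j : Fin 7) → σ 0 j ≡ γ j)
     × σ len pEnd ≡ x × σ len qEnd ≡ y
     × ((i : ℕ) → i < len → σ i pEnd ≡ γ pEnd × σ i qEnd ≡ γ qEnd)
     × ((j : Fin 7) → Internal j →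
          Σ ℕ λ t → (i : ℕ) → i ≤ len →
            (i ≤ t → σ i j ≡ σ 0 j) × (t < i → σ i j ≡ σ len j)))

IsSimple : (n m : ℕ) → (Fin m → Fin n × Fin n) → Set
IsSimple n m ends =
  ((e : Fin m) → proj₁ (ends e) ≢ proj₂ (ends e)) ×
  ((e e' : Fin m) → (ends e ≡ ends e' ⊎ ends e ≡ swap (ends e')) → e ≡ e')

data V' (n m : ℕ) : Set where
  orig  : Fin n → V' n m
  xv yv zv : Fin m → V' n m
  inner : Fin m → Fin 8 → Fin 5 → V' n m   -- internal vertices of the 8 gadget paths
  va vb vc vd : V' n m

module Construction {n m : ℕ} (ends : Fin m → Fin n × Fin n)
                    (intL : Fin m → Fin 8 → Fin 5 → ColList) where

  src tgt : Fin m → Fin n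
  src e = proj₁ (ends e)
  tgt e = proj₂ (ends e)

  rOf sOf : Fin 8 → Colour
  rOf zero = c1
  rOf (suc zero) = c3
  rOf (suc (suc zero)) = c2
  rOf (suc (suc (suc zero))) = c2
  rOf (suc (suc (suc (suc zero)))) = c3
  rOf (suc (suc (suc (suc (suc zero))))) = c1
  rOf (suc (suc (suc (suc (suc (suc zero)))))) = c4
  rOf (suc (suc (suc (suc (suc (suc (suc zero))))))) = c4
  sOf zero = c2
  sOf (suc zero) = c1
  sOf (suc (suc zero)) = c3
  sOf (suc (suc (suc zero))) = c1
  sOf (suc (suc (suc (suc zero)))) = c2
  sOf (suc (suc (suc (suc (suc zero))))) = c3
  sOf (suc (suc (suc (suc (suc (suc zero)))))) = c1
  sOf (suc (suc (suc (suc (suc (suc (suc zero))))))) = c2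

  startOf endOf : Fin m → Fin 8 → V' n m
  startOf e zero = orig (src e)
  startOf e (suc zero) = orig (src e)
  startOf e (suc (suc zero)) = orig (src e)
  startOf e (suc (suc (suc zero))) = orig (tgt e)
  startOf e (suc (suc (suc (suc zero)))) = orig (tgt e)
  startOf e (suc (suc (suc (suc (suc zero))))) = orig (tgt e)
  startOf e (suc (suc (suc (suc (suc (suc zero)))))) = xv e
  startOf e (suc (suc (suc (suc (suc (suc (suc zero))))))) = yv e
  endOf e zero = xv e
  endOf e (suc zero) = xv e
  endOf e (suc (suc zero)) = yv e
  endOf e (suc (suc (suc zero))) = xv e
  endOf e (suc (suc (suc (suc zero)))) = xv e
  endOf e (suc (suc (suc (suc (suc zero))))) = yv e
  endOf e (suc (suc (suc (suc (suc (suc zero)))))) = zv e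
  endOf e (suc (suc (suc (suc (suc (suc (suc zero))))))) = zv e

  pathVertex : Fin m → Fin 8 → Fin 7 → V' n m
  pathVertex e k zero = startOf e k
  pathVertex e k (suc zero) = inner e k zero
  pathVertex e k (suc (suc zero)) = inner e k (suc zero)
  pathVertex e k (suc (suc (suc zero))) = inner e k (suc (suc zero))
  pathVertex e k (suc (suc (suc (suc zero)))) = inner e k (suc (suc (suc zero)))
  pathVertex e k (suc (suc (suc (suc (suc zero))))) = inner e k (suc (suc (suc (suc zero))))
  pathVertex e k (suc (suc (suc (suc (suc (suc zero)))))) = endOf e k

  L123 L124 L34 L12 L4 : ColList
  L123 c1 = true
  L123 c2 = true
  L123 c3 = true
  L123 c4 = false
  L124 c1 = true
  L124 c2 = true
  L124 c3 = false
  L124 c4 = true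
  L34 c1 = false
  L34 c2 = false
  L34 c3 = true
  L34 c4 = true
  L12 c1 = true
  L12 c2 = true
  L12 c3 = false
  L12 c4 = false
  L4 c1 = false
  L4 c2 = false
  L4 c3 = false
  L4 c4 = true

  L : V' n m → ColList
  L (orig _) = L123
  L (xv _) = L124
  L (yv _) = L34
  L (zv _) = L124
  L (inner e k j) = intL e k j
  L va = L123
  L vb = L12
  L vc = L34
  L vd = L4

  -- edges of G' (each listed once, in some direction)
  data Edge : V' n m → V' n m → Set where
    e-ux  : (e : Fin m) → Edge (orig (src e)) (xv e)
    e-uy  : (e : Fin m) → Edge (orig (src e)) (yv e)
    e-pth : (e : Fin m) (k : Fin 8) (i : Fin 6) →
            Edge (pathVertex e k (inject₁ i)) (pathVertex e k (suc i))
    e-ab  : Edge va vb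
    e-ac  : Edge va vc
    e-ad  : Edge va vd
    e-bc  : Edge vb vc
    e-bd  : Edge vb vd
    e-zc  : (e : Fin m) → Edge (zv e) vc

  Adj : V' n m → V' n m → Set
  Adj u w = Edge u w ⊎ Edge w u

  GadgetsForbidding : Set
  GadgetsForbidding =
    (e : Fin m) (k : Fin 8) → IsForbidding (rOf k) (sOf k) (λ i → L (pathVertex e k i))

-- Each gadget path from p to q forbids exactly the pair (r, s) at its ends.
-- If γ(u) = γ(v), the four paths into x together with the edge ux leave x
-- only the colour 4, likewise the paths into y and the edge uy leave y only 4,
-- and then the paths xz and yz exclude 1 and 2 at z.  If γ(u) ≠ γ(v), one can
-- recolour x to 1 or 2 (when γ(u) ≠ 1) or y to 3 (when γ(u) = 1), and then z
-- to 1 or 2.  Before an end of a gadget path is recoloured, property (ii) of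
-- the path adapts its interior, recolouring each of the five internal vertices
-- at most once; after dropping idle steps this costs at most five steps, so
-- the length of the whole sequence is bounded independently of G.
module Submission where

open import Defs
open import Data.Empty using (⊥-elim)
open import Data.Fin using (Fin; zero; suc; toℕ; inject₁)
open import Data.Fin.Properties
  using (_≟_; toℕ-inject₁; toℕ<n; suc-injective; inject₁-injective; fromℕ≢inject₁)
open import Data.List using (List; length; _++_; _∷_; tabulate)
open import Data.List.Membership.Propositional using (_∈_; _∉_)
open import Data.List.Membership.Propositional.Properties
  using (∈-∃++; ∈-++⁻; ∈-++⁺ˡ; ∈-++⁺ʳ; ∈-tabulate⁺)
open import Data.List.Properties using (length-++-sucʳ; length-tabulate)
open import Data.List.Relation.Unary.Any using (here; there)
open import Data.Nat using (ℕ; zero; suc; _+_; _≤_; _<_; z≤n; s≤s)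
open import Data.Nat.Properties
  using (≤-refl; ≤-reflexive; n<1+n; m≤n+m; m≤m+n; <⇒≤; <-trans; <-irrefl; <-cmp;
         m<n⇒m<1+n; m≤n⇒m≤1+n; m≤n⇒m<n∨m≡n)
import Data.Nat.Properties as ℕ
open import Data.List.Membership.DecPropositional ℕ._≟_ using (_∈?_)
open import Data.Product using (Σ; _×_; _,_; proj₁; proj₂)
open import Data.Sum using (_⊎_; inj₁; inj₂)
open import Data.Unit using (tt)
open import Data.Vec.Functional using (updateAt)
open import Data.Vec.Functional.Properties using (updateAt-updates; updateAt-minimal)
open import Function using (_∘_)
open import Relation.Binary.Definitions using (tri<; tri≈; tri>)
open import Relation.Binary.PropositionalEquality
  using (_≡_; _≢_; refl; sym; trans; subst; cong; cong-app; _≗_; ≢-sym)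
open import Relation.Nullary using (yes; no)

≡-≢-trans : ∀ {A : Set} {a b c : A} → a ≡ b → b ≢ c → a ≢ c
≡-≢-trans refl b≢c = b≢c

IsLColoring-resp : ∀ {V : Set} {Adj : V → V → Set} (L : V → ColList) {α β : V → Colour} →
                   α ≗ β → IsLColoring Adj L α → IsLColoring Adj L β
IsLColoring-resp L α≗β (inList , proper) =
  (λ w → subst (_∈L L w) (α≗β w) (inList w)) ,
  (λ w w′ adj eq → proper w w′ adj (trans (α≗β w) (trans eq (sym (α≗β w′)))))

AtMostOneDiff-resp : ∀ {V : Set} {α α′ β β′ : V → Colour} → α ≗ α′ → β ≗ β′ →
                     AtMostOneDiff α β → AtMostOneDiff α′ β′
AtMostOneDiff-resp α≗α′ β≗β′ (v , agree) =
  v , λ w w≢v → trans (sym (α≗α′ w)) (trans (agree w w≢v) (β≗β′ w))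

module Recolourings {V : Set} (Adj : V → V → Set) (L : V → ColList) where

  -- Recolouring k α β: an L-recolouring sequence of length at most k from α
  -- to a colouring pointwise equal to β.
  data Recolouring : ℕ → (V → Colour) → (V → Colour) → Set where
    stay     : ∀ {k α β} → IsLColoring Adj L α → α ≗ β → Recolouring k α β
    recolour : ∀ {k α β δ} → IsLColoring Adj L α → AtMostOneDiff α β →
               Recolouring k β δ → Recolouring (suc k) α δ

  weaken : ∀ {k l α β} → k ≤ l → Recolouring k α β → Recolouring l α β
  weaken _ (stay α-ok α≗β) = stay α-ok α≗β
  weaken (s≤s k≤l) (recolour α-ok diff rest) = recolour α-ok diff (weaken k≤l rest)

  resp-source : ∀ {k α α′ β} → α ≗ α′ → Recolouring k α′ β → Recolouring k α β
  resp-source α≗α′ (stay α′-ok α′≗β) =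
    stay (IsLColoring-resp L (sym ∘ α≗α′) α′-ok) (λ w → trans (α≗α′ w) (α′≗β w))
  resp-source α≗α′ (recolour α′-ok diff rest) =
    recolour (IsLColoring-resp L (sym ∘ α≗α′) α′-ok) (AtMostOneDiff-resp (sym ∘ α≗α′) (λ _ → refl) diff) rest

  resp-target : ∀ {k α β β′} → β ≗ β′ → Recolouring k α β → Recolouring k α β′
  resp-target β≗β′ (stay α-ok α≗β) = stay α-ok (λ w → trans (α≗β w) (β≗β′ w))
  resp-target β≗β′ (recolour α-ok diff rest) = recolour α-ok diff (resp-target β≗β′ rest)

  infixr 5 _⨾_
  _⨾_ : ∀ {k l α β δ} → Recolouring k α β → Recolouring l β δ → Recolouring (k + l) α δ
  _⨾_ {k} (stay _ α≗β) rest = weaken (m≤n+m _ k) (resp-source α≗β rest)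
  recolour α-ok diff first ⨾ rest = recolour α-ok diff (first ⨾ rest)

  single : ∀ {α β} → IsLColoring Adj L α → IsLColoring Adj L β → AtMostOneDiff α β →
           Recolouring 1 α β
  single α-ok β-ok diff = recolour α-ok diff (stay β-ok (λ _ → refl))

  snoc : ∀ {k α β δ} → Recolouring k α β → IsLColoring Adj L δ → AtMostOneDiff β δ →
         Recolouring (suc k) α δ
  snoc (stay α-ok α≗β) δ-ok diff =
    recolour α-ok (AtMostOneDiff-resp (sym ∘ α≗β) (λ _ → refl) diff) (stay δ-ok (λ _ → refl))
  snoc (recolour α-ok diff rest) δ-ok diff′ = recolour α-ok diff (snoc rest δ-ok diff′)

  IsRecolSeq-prefix : ∀ {len σ} → IsRecolSeq Adj L (suc len) σ → IsRecolSeq Adj L len σ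
  IsRecolSeq-prefix (proper , steps) =
    (λ i i≤len → proper i (m≤n⇒m≤1+n i≤len)) , (λ i i<len → steps i (m<n⇒m<1+n i<len))

  private
    ∈-remove : ∀ {i d} (D₁ D₂ : List ℕ) → i ≢ d → i ∈ D₁ ++ d ∷ D₂ → i ∈ D₁ ++ D₂
    ∈-remove D₁ D₂ i≢d i∈D with ∈-++⁻ D₁ i∈D
    ... | inj₁ i∈D₁ = ∈-++⁺ˡ i∈D₁
    ... | inj₂ (here i≡d) = ⊥-elim (i≢d i≡d)
    ... | inj₂ (there i∈D₂) = ∈-++⁺ʳ D₁ i∈D₂

  -- A step is kept only if its index occurs in D, and then one occurrence
  -- is removed from D to pay for it.
  compress : ∀ {len σ} (D : List ℕ) → IsRecolSeq Adj L len σ →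
             (∀ i → i < len → i ∉ D → σ i ≗ σ (suc i)) →
             Recolouring (length D) (σ 0) (σ len)
  compress {zero} D (proper , _) idle = stay (proper 0 z≤n) (λ _ → refl)
  compress {suc len} {σ} D seq idle with len ∈? D
  ... | no len∉D =
    resp-target (idle len ≤-refl len∉D)
                (compress D (IsRecolSeq-prefix seq) (λ i i<len → idle i (m<n⇒m<1+n i<len)))
  ... | yes len∈D with ∈-∃++ len∈D
  ...   | D₁ , D₂ , refl =
    weaken (≤-reflexive (sym (length-++-sucʳ D₁ len D₂)))
           (snoc (compress (D₁ ++ D₂) (IsRecolSeq-prefix seq) idle′)
                 (proj₁ seq (suc len) ≤-refl) (proj₂ seq len ≤-refl))
    where
      idle′ : ∀ i → i < len → i ∉ D₁ ++ D₂ → σ i ≗ σ (suc i)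
      idle′ i i<len i∉D = idle i (m<n⇒m<1+n i<len)
        (i∉D ∘ ∈-remove D₁ D₂ (λ { refl → <-irrefl refl i<len }))

  toSequence : ∀ {k α β} → Recolouring k α β →
               Σ ℕ λ len → Σ (ℕ → V → Colour) λ σ →
                 len ≤ k × IsRecolSeq Adj L len σ × (∀ w → σ 0 w ≡ α w) × (∀ w → σ len w ≡ β w)
  toSequence {α = α} (stay α-ok α≗β) =
    0 , (λ _ → α) , z≤n , ((λ _ _ → α-ok) , λ _ ()) , (λ _ → refl) , α≗β
  toSequence {α = α} (recolour α-ok diff rest) with toSequence rest
  ... | len , σ , len≤k , (proper , steps) , σ₀≗β , σ-end =
    suc len , σ′ , s≤s len≤k , (proper′ , steps′) , (λ _ → refl) , σ-end
    where
      σ′ : ℕ → V → Colour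
      σ′ zero = α
      σ′ (suc i) = σ i
      proper′ : ∀ i → i ≤ suc len → IsLColoring Adj L (σ′ i)
      proper′ zero _ = α-ok
      proper′ (suc i) (s≤s i≤len) = proper i i≤len
      steps′ : ∀ i → i < suc len → AtMostOneDiff (σ′ i) (σ′ (suc i))
      steps′ zero _ = AtMostOneDiff-resp (λ _ → refl) (sym ∘ σ₀≗β) diff
      steps′ (suc i) (s≤s i<len) = steps i i<len

pattern sixth = suc (suc (suc (suc (suc (suc zero)))))

interiorPos : Fin 5 → Fin 7
interiorPos j = suc (inject₁ j)

interiorPos-injective : ∀ {j j′} → interiorPos j ≡ interiorPos j′ → j ≡ j′
interiorPos-injective = inject₁-injective ∘ suc-injective

interiorPos-internal : ∀ j → Internal (interiorPos j)
interiorPos-internal j = s≤s z≤n , s≤s (subst (_< 5) (sym (toℕ-inject₁ j)) (toℕ<n j))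

interiorPos≢qEnd : ∀ j → interiorPos j ≢ qEnd
interiorPos≢qEnd j eq = fromℕ≢inject₁ (sym (suc-injective eq))

data Position : Fin 7 → Set where
  start    : Position pEnd
  interior : ∀ j → Position (interiorPos j)
  end      : Position qEnd

position : ∀ i → Position i
position zero = start
position (suc zero) = interior zero
position (suc (suc zero)) = interior (suc zero)
position (suc (suc (suc zero))) = interior (suc (suc zero))
position (suc (suc (suc (suc zero)))) = interior (suc (suc (suc zero)))
position (suc (suc (suc (suc (suc zero))))) = interior (suc (suc (suc (suc zero))))
position sixth = end

splice : Colour → (Fin 5 → Colour) → Colour → Fin 7 → Colour
splice s ρ t zero = s
splice s ρ t (suc zero) = ρ zero
splice s ρ t (suc (suc zero)) = ρ (suc zero)
splice s ρ t (suc (suc (suc zero))) = ρ (suc (suc zero))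
splice s ρ t (suc (suc (suc (suc zero)))) = ρ (suc (suc (suc zero)))
splice s ρ t (suc (suc (suc (suc (suc zero))))) = ρ (suc (suc (suc (suc zero))))
splice s ρ t sixth = t

splice-interior : ∀ s ρ t j → splice s ρ t (interiorPos j) ≡ ρ j
splice-interior s ρ t zero = refl
splice-interior s ρ t (suc zero) = refl
splice-interior s ρ t (suc (suc zero)) = refl
splice-interior s ρ t (suc (suc (suc zero))) = refl
splice-interior s ρ t (suc (suc (suc (suc zero)))) = refl

splice-cong : ∀ s t {ρ ρ′} → ρ ≗ ρ′ → splice s ρ t ≗ splice s ρ′ t
splice-cong s t {ρ} {ρ′} ρ≗ρ′ i with position i
... | start = refl
... | interior j = trans (splice-interior s ρ t j) (trans (ρ≗ρ′ j) (sym (splice-interior s ρ′ t j)))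
... | end = refl

splice-restrict : ∀ (β : Fin 7 → Colour) {s t} → β pEnd ≡ s → β qEnd ≡ t →
                  splice s (β ∘ interiorPos) t ≗ β
splice-restrict β {s} {t} βp≡s βq≡t i with position i
... | start = sym βp≡s
... | interior j = splice-interior s (β ∘ interiorPos) t j
... | end = sym βq≡t

PathAdj-consecutive : ∀ {n} (i j : Fin (suc n)) → toℕ j ≡ suc (toℕ i) →
                      Σ (Fin n) λ i′ → i ≡ inject₁ i′ × j ≡ suc i′
PathAdj-consecutive {zero} zero zero ()
PathAdj-consecutive {suc n} zero zero ()
PathAdj-consecutive {suc n} zero (suc zero) refl = zero , refl , refl
PathAdj-consecutive {suc n} zero (suc (suc j)) ()
PathAdj-consecutive {suc n} (suc i) (suc j) eq with PathAdj-consecutive i j (ℕ.suc-injective eq)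
... | i′ , refl , refl = suc i′ , refl , refl

-- The ends stay fixed until the last step, and that step recolours either an
-- end (leaving the interior alone) or an interior vertex (leaving the ends).
splice-proper : ∀ {P len σ s t} → IsRecolSeq PathAdj P len σ →
  σ 0 pEnd ≡ s → σ 0 qEnd ≡ t → (∀ i → i < len → σ i pEnd ≡ s × σ i qEnd ≡ t) →
  ∀ i → i ≤ len → IsLColoring PathAdj P (splice s (σ i ∘ interiorPos) t)
splice-proper {P} {len} {σ} {s} {t} (proper , steps) p₀ q₀ fixed i i≤len with m≤n⇒m<n∨m≡n i≤len
... | inj₁ i<len = restricted i (proj₁ (fixed i i<len)) (proj₂ (fixed i i<len)) (proper i i≤len)
  where
    restricted : ∀ i → σ i pEnd ≡ s → σ i qEnd ≡ t → IsLColoring PathAdj P (σ i) →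
                 IsLColoring PathAdj P (splice s (σ i ∘ interiorPos) t)
    restricted i p q = IsLColoring-resp P (sym ∘ splice-restrict (σ i) p q)
... | inj₂ refl = final len ≤-refl
  where
    final : ∀ l → l ≤ len → IsLColoring PathAdj P (splice s (σ l ∘ interiorPos) t)
    final zero _ = IsLColoring-resp P (sym ∘ splice-restrict (σ 0) p₀ q₀) (proper 0 z≤n)
    final (suc l) l<len with steps l l<len | fixed l l<len
    ... | v , agree | p , q with position v
    ... | start = IsLColoring-resp P (λ w → trans (sym (splice-restrict (σ l) p q w))
                                                (splice-cong s t (λ j → agree (interiorPos j) (λ ())) w))
                                   (proper l (<⇒≤ l<len))
    ... | end = IsLColoring-resp P (λ w → trans (sym (splice-restrict (σ l) p q w))
                                              (splice-cong s t (λ j → agree (interiorPos j) (interiorPos≢qEnd j)) w))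
                                 (proper l (<⇒≤ l<len))
    ... | interior j = IsLColoring-resp P (sym ∘ splice-restrict (σ (suc l)) p′ q′) (proper (suc l) l<len)
      where
        p′ : σ (suc l) pEnd ≡ s
        p′ = trans (sym (agree pEnd (λ ()))) p
        q′ : σ (suc l) qEnd ≡ t
        q′ = trans (sym (agree qEnd (interiorPos≢qEnd j ∘ sym))) q

recolouredOnce-idle : ∀ {len t} (f : ℕ → Colour) →
  (∀ i → i ≤ len → (i ≤ t → f i ≡ f 0) × (t < i → f i ≡ f len)) →
  ∀ i → i < len → i ≢ t → f i ≡ f (suc i)
recolouredOnce-idle {t = t} f once i i<len i≢t with <-cmp i t
... | tri< i<t _ _ = trans (proj₁ (once i (<⇒≤ i<len)) (<⇒≤ i<t)) (sym (proj₁ (once (suc i) i<len) i<t))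
... | tri≈ _ i≡t _ = ⊥-elim (i≢t i≡t)
... | tri> _ _ t<i = trans (proj₂ (once i (<⇒≤ i<len)) t<i)
                           (sym (proj₂ (once (suc i) i<len) (<-trans t<i (n<1+n i))))

module Gadget {n m : ℕ} (ends : Fin m → Fin n × Fin n) (intL : Fin m → Fin 8 → Fin 5 → ColList)
              (forbidding : Construction.GadgetsForbidding ends intL)
              (γ : V' n m → Colour)
              (γ-proper : IsLColoring (Construction.Adj ends intL) (Construction.L ends intL) γ)
              (e : Fin m) where

  open Construction ends intL
  open Recolourings Adj L

  -- The eight forbidding paths of a gadget, named by their ends.
  pattern ux₁ = zero
  pattern ux₂ = suc zero
  pattern uy  = suc (suc zero)
  pattern vx₁ = suc (suc (suc zero))
  pattern vx₂ = suc (suc (suc (suc zero)))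
  pattern vy  = suc (suc (suc (suc (suc zero))))
  pattern xz  = suc (suc (suc (suc (suc (suc zero)))))
  pattern yz  = suc (suc (suc (suc (suc (suc (suc zero))))))

  forEachPath : {F : Fin 8 → Set} → F ux₁ → F ux₂ → F uy → F vx₁ → F vx₂ → F vy → F xz → F yz →
                ∀ k → F k
  forEachPath f₁ f₂ f₃ f₄ f₅ f₆ f₇ f₈ ux₁ = f₁
  forEachPath f₁ f₂ f₃ f₄ f₅ f₆ f₇ f₈ ux₂ = f₂
  forEachPath f₁ f₂ f₃ f₄ f₅ f₆ f₇ f₈ uy = f₃
  forEachPath f₁ f₂ f₃ f₄ f₅ f₆ f₇ f₈ vx₁ = f₄
  forEachPath f₁ f₂ f₃ f₄ f₅ f₆ f₇ f₈ vx₂ = f₅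
  forEachPath f₁ f₂ f₃ f₄ f₅ f₆ f₇ f₈ vy = f₆
  forEachPath f₁ f₂ f₃ f₄ f₅ f₆ f₇ f₈ xz = f₇
  forEachPath f₁ f₂ f₃ f₄ f₅ f₆ f₇ f₈ yz = f₈

  u v : V' n m
  u = orig (src e)
  v = orig (tgt e)

  PL : Fin 8 → Fin 7 → ColList
  PL k = L ∘ pathVertex e k

  γ-inList : ∀ w → γ w ∈L L w
  γ-inList = proj₁ γ-proper

  γ-edge : ∀ {a b} → Edge a b → γ a ≢ γ b
  γ-edge edge = proj₂ γ-proper _ _ (inj₁ edge)

  γ-onPath : ∀ k → IsLColoring PathAdj (PL k) (γ ∘ pathVertex e k)
  γ-onPath k = γ-inList ∘ pathVertex e k , proper
    where
      proper : ∀ i j → PathAdj i j → γ (pathVertex e k i) ≢ γ (pathVertex e k j)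
      proper i j (inj₁ j≡1+i) with PathAdj-consecutive i j j≡1+i
      ... | i′ , refl , refl = γ-edge (e-pth e k i′)
      proper i j (inj₂ i≡1+j) with PathAdj-consecutive j i i≡1+j
      ... | i′ , refl , refl = γ-edge (e-pth e k i′) ∘ sym

  atEdge : Fin m → Colour → Colour → Colour
  atEdge e′ c d with e′ ≟ e
  ... | yes _ = c
  ... | no _ = d

  atEdge-self : ∀ {c d} → atEdge e c d ≡ c
  atEdge-self with e ≟ e
  ... | yes _ = refl
  ... | no e≢e = ⊥-elim (e≢e refl)

  atEdge-same : ∀ e′ {c d} → (e′ ≡ e → c ≡ d) → atEdge e′ c d ≡ d
  atEdge-same e′ c≡d with e′ ≟ e
  ... | yes e′≡e = c≡d e′≡e
  ... | no _ = refl

  atEdge-cong : ∀ e′ {c c′ d} → (e′ ≡ e → c ≡ c′) → atEdge e′ c d ≡ atEdge e′ c′ d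
  atEdge-cong e′ c≡c′ with e′ ≟ e
  ... | yes e′≡e = c≡c′ e′≡e
  ... | no _ = refl

  -- A recolouring of the gadget of e is given by the colours of its terminals
  -- and of the interiors of its paths; keeping the two apart makes the colouring
  -- of path k depend definitionally on the interior of path k only.
  record Terminals : Set where
    field
      colX colY colZ : Colour

  open Terminals

  Interiors : Set
  Interiors = Fin 8 → Fin 5 → Colour

  terminalColour : Terminals → V' n m → Colour
  terminalColour T (xv _) = colX T
  terminalColour T (yv _) = colY T
  terminalColour T (zv _) = colZ T
  terminalColour T w = γ w

  startColour endColour : Terminals → Fin 8 → Colour
  startColour T k = terminalColour T (startOf e k)
  endColour T k = terminalColour T (endOf e k)

  pathColouring : Terminals → Interiors → Fin 8 → Fin 7 → Colour
  pathColouring T P k = splice (startColour T k) (P k) (endColour T k)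

  colour : Terminals → Interiors → V' n m → Colour
  colour T P (xv e′) = atEdge e′ (colX T) (γ (xv e′))
  colour T P (yv e′) = atEdge e′ (colY T) (γ (yv e′))
  colour T P (zv e′) = atEdge e′ (colZ T) (γ (zv e′))
  colour T P (inner e′ k j) = atEdge e′ (P k j) (γ (inner e′ k j))
  colour T P w = γ w

  colour-pathVertex : ∀ T P e′ k i →
    colour T P (pathVertex e′ k i) ≡
    atEdge e′ (splice (terminalColour T (startOf e′ k)) (P k) (terminalColour T (endOf e′ k)) i)
              (γ (pathVertex e′ k i))
  colour-pathVertex T P e′ ux₁ zero = sym (atEdge-same e′ λ _ → refl)
  colour-pathVertex T P e′ ux₂ zero = sym (atEdge-same e′ λ _ → refl)
  colour-pathVertex T P e′ uy zero = sym (atEdge-same e′ λ _ → refl)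
  colour-pathVertex T P e′ vx₁ zero = sym (atEdge-same e′ λ _ → refl)
  colour-pathVertex T P e′ vx₂ zero = sym (atEdge-same e′ λ _ → refl)
  colour-pathVertex T P e′ vy zero = sym (atEdge-same e′ λ _ → refl)
  colour-pathVertex T P e′ xz zero = refl
  colour-pathVertex T P e′ yz zero = refl
  colour-pathVertex T P e′ k (suc zero) = refl
  colour-pathVertex T P e′ k (suc (suc zero)) = refl
  colour-pathVertex T P e′ k (suc (suc (suc zero))) = refl
  colour-pathVertex T P e′ k (suc (suc (suc (suc zero)))) = refl
  colour-pathVertex T P e′ k (suc (suc (suc (suc (suc zero))))) = refl
  colour-pathVertex T P e′ ux₁ sixth = refl
  colour-pathVertex T P e′ ux₂ sixth = refl
  colour-pathVertex T P e′ uy sixth = refl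
  colour-pathVertex T P e′ vx₁ sixth = refl
  colour-pathVertex T P e′ vx₂ sixth = refl
  colour-pathVertex T P e′ vy sixth = refl
  colour-pathVertex T P e′ xz sixth = refl
  colour-pathVertex T P e′ yz sixth = refl

  colour-path : ∀ T P k i → colour T P (pathVertex e k i) ≡ pathColouring T P k i
  colour-path T P k i = trans (colour-pathVertex T P e k i) atEdge-self

  colour-foreignPath : ∀ T P {e′} → e′ ≢ e → ∀ k i →
                       colour T P (pathVertex e′ k i) ≡ γ (pathVertex e′ k i)
  colour-foreignPath T P {e′} e′≢e k i =
    trans (colour-pathVertex T P e′ k i) (atEdge-same e′ (⊥-elim ∘ e′≢e))

  data Part : Set where
    x y z : Part
    internal : Fin 8 → Fin 5 → Part

  gadgetVertex : Part → V' n m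
  gadgetVertex x = xv e
  gadgetVertex y = yv e
  gadgetVertex z = zv e
  gadgetVertex (internal k j) = inner e k j

  part : Terminals → Interiors → Part → Colour
  part T P x = colX T
  part T P y = colY T
  part T P z = colZ T
  part T P (internal k j) = P k j

  colour-cong : ∀ {T T′ P P′} w → (∀ π → w ≡ gadgetVertex π → part T P π ≡ part T′ P′ π) →
                colour T P w ≡ colour T′ P′ w
  colour-cong (orig _) _ = refl
  colour-cong (xv e′) agree = atEdge-cong e′ λ { refl → agree x refl }
  colour-cong (yv e′) agree = atEdge-cong e′ λ { refl → agree y refl }
  colour-cong (zv e′) agree = atEdge-cong e′ λ { refl → agree z refl }
  colour-cong (inner e′ k j) agree = atEdge-cong e′ λ { refl → agree (internal k j) refl }
  colour-cong va _ = refl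
  colour-cong vb _ = refl
  colour-cong vc _ = refl
  colour-cong vd _ = refl

  colour-diff : ∀ {T T′ P P′} π₀ → (∀ π → π ≢ π₀ → part T P π ≡ part T′ P′ π) →
                AtMostOneDiff (colour T P) (colour T′ P′)
  colour-diff π₀ agree =
    gadgetVertex π₀ , λ w w≢π₀ → colour-cong w λ π w≡π → agree π λ { refl → w≢π₀ w≡π }

  -- The edges of G′ at the gadget of e are ux, uy, zc and the edges of its paths.
  record Valid (T : Terminals) (P : Interiors) : Set where
    field
      x≢u : colX T ≢ γ u
      y≢u : colY T ≢ γ u
      z≢c : colZ T ≢ γ vc
      paths : ∀ k → IsLColoring PathAdj (PL k) (pathColouring T P k)

  open Valid

  interior-inList : ∀ T P k → IsLColoring PathAdj (PL k) (pathColouring T P k) →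
                    ∀ j → P k j ∈L intL e k j
  interior-inList T P k (inList , _) zero = inList (suc zero)
  interior-inList T P k (inList , _) (suc zero) = inList (suc (suc zero))
  interior-inList T P k (inList , _) (suc (suc zero)) = inList (suc (suc (suc zero)))
  interior-inList T P k (inList , _) (suc (suc (suc zero))) = inList (suc (suc (suc (suc zero))))
  interior-inList T P k (inList , _) (suc (suc (suc (suc zero)))) = inList (suc (suc (suc (suc (suc zero)))))

  colour-proper : ∀ {T P} → Valid T P → IsLColoring Adj L (colour T P)
  colour-proper {T} {P} valid =
    inList , λ a b → λ { (inj₁ edge) → proper edge ; (inj₂ edge) → proper edge ∘ sym }
    where
      inList : ∀ w → colour T P w ∈L L w
      inList (xv e′) with e′ ≟ e
      ... | yes refl = proj₁ (paths valid ux₁) qEnd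
      ... | no _ = γ-inList (xv e′)
      inList (yv e′) with e′ ≟ e
      ... | yes refl = proj₁ (paths valid uy) qEnd
      ... | no _ = γ-inList (yv e′)
      inList (zv e′) with e′ ≟ e
      ... | yes refl = proj₁ (paths valid xz) qEnd
      ... | no _ = γ-inList (zv e′)
      inList (inner e′ k j) with e′ ≟ e
      ... | yes refl = interior-inList T P k (paths valid k) j
      ... | no _ = γ-inList (inner e′ k j)
      inList (orig w) = γ-inList (orig w)
      inList va = γ-inList va
      inList vb = γ-inList vb
      inList vc = γ-inList vc
      inList vd = γ-inList vd
      proper : ∀ {a b} → Edge a b → colour T P a ≢ colour T P b
      proper (e-ux e′) with e′ ≟ e
      ... | yes refl = x≢u valid ∘ sym
      ... | no _ = γ-edge (e-ux e′)
      proper (e-uy e′) with e′ ≟ e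
      ... | yes refl = y≢u valid ∘ sym
      ... | no _ = γ-edge (e-uy e′)
      proper (e-zc e′) with e′ ≟ e
      ... | yes refl = z≢c valid
      ... | no _ = γ-edge (e-zc e′)
      proper (e-pth e′ k i) with e′ ≟ e
      ... | yes refl = λ eq →
        proj₂ (paths valid k) (inject₁ i) (suc i) (inj₁ (cong suc (sym (toℕ-inject₁ i))))
              (trans (sym (colour-path T P k (inject₁ i))) (trans eq (colour-path T P k (suc i))))
      ... | no e′≢e = λ eq → γ-edge (e-pth e′ k i)
        (trans (sym (colour-foreignPath T P e′≢e k (inject₁ i))) (trans eq (colour-foreignPath T P e′≢e k (suc i))))
      proper e-ab = γ-edge e-ab
      proper e-ac = γ-edge e-ac
      proper e-ad = γ-edge e-ad
      proper e-bc = γ-edge e-bc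
      proper e-bd = γ-edge e-bd

  T₀ : Terminals
  T₀ = record { colX = γ (xv e) ; colY = γ (yv e) ; colZ = γ (zv e) }

  P₀ : Interiors
  P₀ k j = γ (inner e k j)

  colour₀ : colour T₀ P₀ ≗ γ
  colour₀ (orig _) = refl
  colour₀ (xv e′) = atEdge-same e′ λ { refl → refl }
  colour₀ (yv e′) = atEdge-same e′ λ { refl → refl }
  colour₀ (zv e′) = atEdge-same e′ λ { refl → refl }
  colour₀ (inner e′ _ _) = atEdge-same e′ λ { refl → refl }
  colour₀ va = refl
  colour₀ vb = refl
  colour₀ vc = refl
  colour₀ vd = refl

  valid₀ : Valid T₀ P₀
  valid₀ = record
    { x≢u = γ-edge (e-ux e) ∘ sym
    ; y≢u = γ-edge (e-uy e) ∘ sym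
    ; z≢c = γ-edge (e-zc e)
    ; paths = λ k → IsLColoring-resp (PL k) (λ i → trans (sym (colour₀ _)) (colour-path T₀ P₀ k i))
                                     (γ-onPath k) }

  withPath : Interiors → Fin 8 → (Fin 5 → Colour) → Interiors
  withPath P k ρ = updateAt P k (λ _ → ρ)

  withPath-cong : ∀ P k {ρ ρ′} k′ j → (k′ ≡ k → ρ j ≡ ρ′ j) → withPath P k ρ k′ j ≡ withPath P k ρ′ k′ j
  withPath-cong P k k′ j same with k′ ≟ k
  ... | yes refl = trans (cong-app (updateAt-updates k P) j)
                         (trans (same refl) (sym (cong-app (updateAt-updates k P) j)))
  ... | no k′≢k = trans (cong-app (updateAt-minimal k′ k P k′≢k) j)
                        (sym (cong-app (updateAt-minimal k′ k P k′≢k) j))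

  withPath-id : ∀ P k {ρ} k′ j → (k′ ≡ k → ρ j ≡ P k j) → withPath P k ρ k′ j ≡ P k′ j
  withPath-id P k k′ j same with k′ ≟ k
  ... | yes refl = trans (cong-app (updateAt-updates k P) j) (same refl)
  ... | no k′≢k = cong-app (updateAt-minimal k′ k P k′≢k) j

  withPath-part : ∀ T P k {ρ ρ′} π → (∀ j → π ≡ internal k j → ρ j ≡ ρ′ j) →
                  part T (withPath P k ρ) π ≡ part T (withPath P k ρ′) π
  withPath-part T P k x _ = refl
  withPath-part T P k y _ = refl
  withPath-part T P k z _ = refl
  withPath-part T P k (internal k′ j) same = withPath-cong P k k′ j λ { refl → same j refl }

  Valid-withPath : ∀ {T P} → Valid T P → ∀ k {ρ} →
                   IsLColoring PathAdj (PL k) (splice (startColour T k) ρ (endColour T k)) →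
                   Valid T (withPath P k ρ)
  Valid-withPath {T} {P} valid k {ρ} ok =
    record { x≢u = x≢u valid ; y≢u = y≢u valid ; z≢c = z≢c valid ; paths = paths′ }
    where
      paths′ : ∀ k′ → IsLColoring PathAdj (PL k′) (pathColouring T (withPath P k ρ) k′)
      paths′ k′ with k′ ≟ k
      ... | yes refl = subst (λ ρ′ → IsLColoring PathAdj (PL k) (splice (startColour T k) ρ′ (endColour T k)))
                             (sym (updateAt-updates k P)) ok
      ... | no k′≢k = subst (λ ρ′ → IsLColoring PathAdj (PL k′) (splice (startColour T k′) ρ′ (endColour T k′)))
                            (sym (updateAt-minimal k′ k P k′≢k)) (paths valid k′)

  liftStep : ∀ T P k {β β′ : Fin 7 → Colour} → AtMostOneDiff β β′ →
             AtMostOneDiff (colour T (withPath P k (β ∘ interiorPos))) (colour T (withPath P k (β′ ∘ interiorPos)))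
  liftStep T P k (i , agree) with position i
  ... | start = colour-diff x λ π _ → withPath-part T P k π λ j _ → agree (interiorPos j) λ ()
  ... | end = colour-diff x λ π _ → withPath-part T P k π λ j _ → agree (interiorPos j) (interiorPos≢qEnd j)
  ... | interior j₀ = colour-diff (internal k j₀) λ π π≢ → withPath-part T P k π λ j π≡ →
          agree (interiorPos j) λ eq → π≢ (trans π≡ (cong (internal k) (interiorPos-injective eq)))

  liftIdle : ∀ T P k {ρ ρ′} → ρ ≗ ρ′ → colour T (withPath P k ρ) ≗ colour T (withPath P k ρ′)
  liftIdle T P k ρ≗ρ′ w = colour-cong w λ π _ → withPath-part T P k π λ j _ → ρ≗ρ′ j

  -- Property (ii) of path k, lifted to G′ with the ends of the path kept
  -- fixed; idle steps are dropped, and at most five remain since each of the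
  -- five internal vertices is recoloured at most once.
  retunePath : ∀ {T P} → Valid T P → ∀ k {a b} → a ∈L PL k pEnd → b ∈L PL k qEnd →
               (a ≢ rOf k ⊎ b ≢ sOf k) → (a ≡ startColour T k ⊎ b ≡ endColour T k) →
               Σ (Fin 5 → Colour) λ ρ →
                 Recolouring 5 (colour T P) (colour T (withPath P k ρ)) ×
                 Valid T (withPath P k ρ) × IsLColoring PathAdj (PL k) (splice a ρ b)
  retunePath {T} {P} valid k a∈ b∈ admissible keepsEnd
    with proj₂ (forbidding e k) (pathColouring T P k) (paths valid k) _ _ a∈ b∈ admissible keepsEnd
  ... | len , σ , seq , σ₀ , σp , σq , endsFixed , once =
    ρ len ,
    resp-source initial (weaken (≤-reflexive (length-tabulate changeTime))
                                (compress (tabulate changeTime) lifted idle)) ,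
    valid′ len ≤-refl ,
    IsLColoring-resp (PL k) (sym ∘ splice-restrict (σ len) σp σq) (proj₁ seq len ≤-refl)
    where
      ρ : ℕ → Fin 5 → Colour
      ρ i = σ i ∘ interiorPos
      valid′ : ∀ i → i ≤ len → Valid T (withPath P k (ρ i))
      valid′ i i≤len = Valid-withPath valid k (splice-proper {P = PL k} seq (σ₀ pEnd) (σ₀ qEnd) endsFixed i i≤len)
      lifted : IsRecolSeq Adj L len (λ i → colour T (withPath P k (ρ i)))
      lifted = (λ i i≤len → colour-proper (valid′ i i≤len)) , (λ i i<len → liftStep T P k (proj₂ seq i i<len))
      changeTime : Fin 5 → ℕ
      changeTime j = proj₁ (once (interiorPos j) (interiorPos-internal j))
      idle : ∀ i → i < len → i ∉ tabulate changeTime →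
             colour T (withPath P k (ρ i)) ≗ colour T (withPath P k (ρ (suc i)))
      idle i i<len i∉ = liftIdle T P k λ j →
        recolouredOnce-idle (λ i′ → σ i′ (interiorPos j)) (proj₂ (once (interiorPos j) (interiorPos-internal j)))
                            i i<len λ { refl → i∉ (∈-tabulate⁺ {f = changeTime} j) }
      initial : colour T P ≗ colour T (withPath P k (ρ 0))
      initial w = colour-cong w λ
        { x _ → refl ; y _ → refl ; z _ → refl
        ; (internal k′ j) _ → sym (withPath-id P k k′ j λ { refl →
                                     trans (σ₀ (interiorPos j)) (splice-interior _ (P k) _ j) }) }

  stepTerminal : ∀ {T T′ P} π₀ → Valid T P → Valid T′ P → (∀ π → π ≢ π₀ → part T P π ≡ part T′ P π) →
                 Recolouring 1 (colour T P) (colour T′ P)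
  stepTerminal π₀ valid valid′ agree = single (colour-proper valid) (colour-proper valid′) (colour-diff π₀ agree)

  recolourZ : ∀ {T P} → Valid T P → ∀ Z → Z ∈L L124 → Z ≢ γ vc →
              (colX T ≢ c4 ⊎ Z ≢ c1) → (colY T ≢ c4 ⊎ Z ≢ c2) →
              Σ Interiors λ P′ → Recolouring 11 (colour T P) (colour (record T { colZ = Z }) P′)
  recolourZ {T} {P} valid Z Z∈ Z≢c ad-xz ad-yz =
    let (ρ₁ , r₁ , valid₁ , ok₁) = retunePath valid xz (proj₁ (paths valid xz) pEnd) Z∈ ad-xz (inj₁ refl)
        (ρ₂ , r₂ , valid₂ , ok₂) = retunePath valid₁ yz (proj₁ (paths valid yz) pEnd) Z∈ ad-yz (inj₁ refl)
        P′ : Interiors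
        P′ = withPath (withPath P xz ρ₁) yz ρ₂
        valid′ : Valid (record T { colZ = Z }) P′
        valid′ = record
          { x≢u = x≢u valid ; y≢u = y≢u valid ; z≢c = Z≢c
          ; paths = forEachPath (paths valid₂ ux₁) (paths valid₂ ux₂) (paths valid₂ uy) (paths valid₂ vx₁)
                                (paths valid₂ vx₂) (paths valid₂ vy) ok₁ ok₂ }
    in P′ , r₁ ⨾ r₂ ⨾ stepTerminal z valid₂ valid′
                        λ { x _ → refl ; y _ → refl ; z z≢z → ⊥-elim (z≢z refl) ; (internal _ _) _ → refl }

  recolourX : ∀ {T P} → Valid T P → ∀ X → X ∈L L124 → X ≢ c4 → X ≢ γ u →
              (γ u ≢ c1 ⊎ X ≢ c2) → (γ u ≢ c3 ⊎ X ≢ c1) → (γ v ≢ c2 ⊎ X ≢ c1) → (γ v ≢ c3 ⊎ X ≢ c2) →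
              Σ Interiors λ P′ → Valid (record T { colX = X }) P′ ×
                                 Recolouring 26 (colour T P) (colour (record T { colX = X }) P′)
  recolourX {T} {P} valid X X∈ X≢4 X≢u ad-ux₁ ad-ux₂ ad-vx₁ ad-vx₂ =
    let (ρ₁ , r₁ , valid₁ , ok₁) = retunePath valid ux₁ (γ-inList u) X∈ ad-ux₁ (inj₁ refl)
        (ρ₂ , r₂ , valid₂ , ok₂) = retunePath valid₁ ux₂ (γ-inList u) X∈ ad-ux₂ (inj₁ refl)
        (ρ₃ , r₃ , valid₃ , ok₃) = retunePath valid₂ vx₁ (γ-inList v) X∈ ad-vx₁ (inj₁ refl)
        (ρ₄ , r₄ , valid₄ , ok₄) = retunePath valid₃ vx₂ (γ-inList v) X∈ ad-vx₂ (inj₁ refl)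
        (ρ₅ , r₅ , valid₅ , ok₅) = retunePath valid₄ xz X∈ (proj₁ (paths valid xz) qEnd) (inj₁ X≢4) (inj₂ refl)
        P′ : Interiors
        P′ = withPath (withPath (withPath (withPath (withPath P ux₁ ρ₁) ux₂ ρ₂) vx₁ ρ₃) vx₂ ρ₄) xz ρ₅
        valid′ : Valid (record T { colX = X }) P′
        valid′ = record
          { x≢u = X≢u ; y≢u = y≢u valid ; z≢c = z≢c valid
          ; paths = forEachPath ok₁ ok₂ (paths valid₅ uy) ok₃ ok₄ (paths valid₅ vy) ok₅ (paths valid₅ yz) }
    in P′ , valid′ , r₁ ⨾ r₂ ⨾ r₃ ⨾ r₄ ⨾ r₅ ⨾ stepTerminal x valid₅ valid′
                       λ { x x≢x → ⊥-elim (x≢x refl) ; y _ → refl ; z _ → refl ; (internal _ _) _ → refl }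

  recolourY : ∀ {T P} → Valid T P → ∀ Y → Y ∈L L34 → Y ≢ c4 → Y ≢ γ u →
              (γ u ≢ c2 ⊎ Y ≢ c3) → (γ v ≢ c1 ⊎ Y ≢ c3) →
              Σ Interiors λ P′ → Valid (record T { colY = Y }) P′ ×
                                 Recolouring 16 (colour T P) (colour (record T { colY = Y }) P′)
  recolourY {T} {P} valid Y Y∈ Y≢4 Y≢u ad-uy ad-vy =
    let (ρ₁ , r₁ , valid₁ , ok₁) = retunePath valid uy (γ-inList u) Y∈ ad-uy (inj₁ refl)
        (ρ₂ , r₂ , valid₂ , ok₂) = retunePath valid₁ vy (γ-inList v) Y∈ ad-vy (inj₁ refl)
        (ρ₃ , r₃ , valid₃ , ok₃) = retunePath valid₂ yz Y∈ (proj₁ (paths valid yz) qEnd) (inj₁ Y≢4) (inj₂ refl)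
        P′ : Interiors
        P′ = withPath (withPath (withPath P uy ρ₁) vy ρ₂) yz ρ₃
        valid′ : Valid (record T { colY = Y }) P′
        valid′ = record
          { x≢u = x≢u valid ; y≢u = Y≢u ; z≢c = z≢c valid
          ; paths = forEachPath (paths valid₃ ux₁) (paths valid₃ ux₂) ok₁ (paths valid₃ vx₁)
                                (paths valid₃ vx₂) ok₂ (paths valid₃ xz) ok₃ }
    in P′ , valid′ , r₁ ⨾ r₂ ⨾ r₃ ⨾ stepTerminal y valid₃ valid′
                       λ { x _ → refl ; y y≢y → ⊥-elim (y≢y refl) ; z _ → refl ; (internal _ _) _ → refl }

  L12-L34-disjoint : ∀ {c d} → c ∈L L12 → d ∈L L34 → c ≢ d
  L12-L34-disjoint {c1} _ () refl
  L12-L34-disjoint {c2} _ () refl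
  L12-L34-disjoint {c3} () _ refl
  L12-L34-disjoint {c4} () _ refl

  ZFreedWithin : ℕ → Set
  ZFreedWithin k = Σ Terminals λ T → Σ Interiors λ P → colZ T ≢ c4 × Recolouring k (colour T₀ P₀) (colour T P)

  -- 26 + 11 steps through x, 16 + 11 through y.
  freeZ-viaX : ∀ X → X ∈L L124 → X ≢ c4 → X ≢ γ u →
               (γ u ≢ c1 ⊎ X ≢ c2) → (γ u ≢ c3 ⊎ X ≢ c1) → (γ v ≢ c2 ⊎ X ≢ c1) → (γ v ≢ c3 ⊎ X ≢ c2) →
               ZFreedWithin 37
  freeZ-viaX X X∈ X≢4 X≢u ad-ux₁ ad-ux₂ ad-vx₁ ad-vx₂ =
    let (P₁ , valid₁ , r₁) = recolourX valid₀ X X∈ X≢4 X≢u ad-ux₁ ad-ux₂ ad-vx₁ ad-vx₂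
        (P₂ , r₂) = recolourZ valid₁ c1 tt (L12-L34-disjoint tt (γ-inList vc)) (inj₁ X≢4) (inj₂ λ ())
    in _ , P₂ , (λ ()) , r₁ ⨾ r₂

  freeZ-viaY : γ u ≡ c1 → γ v ≢ c1 → ZFreedWithin 37
  freeZ-viaY γu≡c1 γv≢c1 =
    let (P₁ , valid₁ , r₁) = recolourY valid₀ c3 tt (λ ()) (≢-sym (≡-≢-trans γu≡c1 λ ()))
                                       (inj₁ (≡-≢-trans γu≡c1 λ ())) (inj₁ γv≢c1)
        (P₂ , r₂) = recolourZ valid₁ c2 tt (L12-L34-disjoint tt (γ-inList vc)) (inj₂ λ ()) (inj₁ λ ())
    in _ , P₂ , (λ ()) , weaken (m≤m+n 27 10) (r₁ ⨾ r₂)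

  freeZ : γ u ≢ γ v → ZFreedWithin 37
  freeZ u≢v with γ u in γu≡
  ... | c1 = freeZ-viaY γu≡ (u≢v ∘ sym)
  ... | c2 = freeZ-viaX c1 tt (λ ()) (≢-sym (≡-≢-trans γu≡ λ ()))
                        (inj₁ (≡-≢-trans γu≡ λ ())) (inj₁ (≡-≢-trans γu≡ λ ())) (inj₁ (u≢v ∘ sym)) (inj₂ λ ())
  ... | c3 = freeZ-viaX c2 tt (λ ()) (≢-sym (≡-≢-trans γu≡ λ ()))
                        (inj₁ (≡-≢-trans γu≡ λ ())) (inj₂ λ ()) (inj₂ λ ()) (inj₁ (u≢v ∘ sym))
  ... | c4 = ⊥-elim (subst (_∈L L123) γu≡ (γ-inList u))

  distinctEnds⇒zRecolourable : γ u ≢ γ v →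
    Σ ℕ λ len → Σ (ℕ → V' n m → Colour) λ σ →
      len ≤ 37 × IsRecolSeq Adj L len σ × (∀ w → σ 0 w ≡ γ w) × σ len (zv e) ≢ c4 ×
      (∀ w → σ len (orig w) ≡ γ (orig w)) × (∀ e′ → e′ ≢ e → σ len (zv e′) ≡ γ (zv e′))
  distinctEnds⇒zRecolourable u≢v with freeZ u≢v
  ... | T , P , z≢4 , recolouring with toSequence recolouring
  ...   | len , σ , len≤37 , seq , σ-start , σ-end =
    len , σ , len≤37 , seq , (λ w → trans (σ-start w) (colour₀ w)) ,
    (λ z≡4 → z≢4 (trans (sym atEdge-self) (trans (sym (σ-end (zv e))) z≡4))) ,
    (λ w → σ-end (orig w)) ,
    (λ e′ e′≢e → trans (σ-end (zv e′)) (atEdge-same e′ (⊥-elim ∘ e′≢e)))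

  endForbidden : ∀ k → γ (startOf e k) ≡ rOf k → γ (endOf e k) ≢ sOf k
  endForbidden k start≡r
    with proj₁ (proj₁ (forbidding e k) _ _ (γ-inList (startOf e k)) (γ-inList (endOf e k)))
               (γ ∘ pathVertex e k , γ-onPath k , refl , refl)
  ... | inj₁ start≢r = ⊥-elim (start≢r start≡r)
  ... | inj₂ end≢s = end≢s

  L124-≢c1-≢c2⇒≡c4 : ∀ {c} → c ∈L L124 → c ≢ c1 → c ≢ c2 → c ≡ c4
  L124-≢c1-≢c2⇒≡c4 {c1} _ c≢1 _ = ⊥-elim (c≢1 refl)
  L124-≢c1-≢c2⇒≡c4 {c2} _ _ c≢2 = ⊥-elim (c≢2 refl)
  L124-≢c1-≢c2⇒≡c4 {c3} ()
  L124-≢c1-≢c2⇒≡c4 {c4} _ _ _ = refl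

  L34-≢c3⇒≡c4 : ∀ {c} → c ∈L L34 → c ≢ c3 → c ≡ c4
  L34-≢c3⇒≡c4 {c1} ()
  L34-≢c3⇒≡c4 {c2} ()
  L34-≢c3⇒≡c4 {c3} _ c≢3 = ⊥-elim (c≢3 refl)
  L34-≢c3⇒≡c4 {c4} _ _ = refl

  x≢u-colour : ∀ {c} → γ u ≡ c → γ (xv e) ≢ c
  x≢u-colour γu≡c x≡c = γ-edge (e-ux e) (trans γu≡c (sym x≡c))

  y≢u-colour : ∀ {c} → γ u ≡ c → γ (yv e) ≢ c
  y≢u-colour γu≡c y≡c = γ-edge (e-uy e) (trans γu≡c (sym y≡c))

  equalEnds⇒x≡c4 : γ u ≡ γ v → γ (xv e) ≡ c4
  equalEnds⇒x≡c4 u≡v with γ u in γu≡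
  ... | c1 = L124-≢c1-≢c2⇒≡c4 (γ-inList (xv e)) (x≢u-colour γu≡) (endForbidden ux₁ γu≡)
  ... | c2 = L124-≢c1-≢c2⇒≡c4 (γ-inList (xv e)) (endForbidden vx₁ (sym u≡v)) (x≢u-colour γu≡)
  ... | c3 = L124-≢c1-≢c2⇒≡c4 (γ-inList (xv e)) (endForbidden ux₂ γu≡) (endForbidden vx₂ (sym u≡v))
  ... | c4 = ⊥-elim (subst (_∈L L123) γu≡ (γ-inList u))

  equalEnds⇒y≡c4 : γ u ≡ γ v → γ (yv e) ≡ c4
  equalEnds⇒y≡c4 u≡v with γ u in γu≡
  ... | c1 = L34-≢c3⇒≡c4 (γ-inList (yv e)) (endForbidden vy (sym u≡v))
  ... | c2 = L34-≢c3⇒≡c4 (γ-inList (yv e)) (endForbidden uy γu≡)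
  ... | c3 = L34-≢c3⇒≡c4 (γ-inList (yv e)) (y≢u-colour γu≡)
  ... | c4 = ⊥-elim (subst (_∈L L123) γu≡ (γ-inList u))

  equalEnds⇒z≡c4 : γ u ≡ γ v → γ (zv e) ≡ c4
  equalEnds⇒z≡c4 u≡v = L124-≢c1-≢c2⇒≡c4 (γ-inList (zv e)) (endForbidden xz (equalEnds⇒x≡c4 u≡v))
                                                           (endForbidden yz (equalEnds⇒y≡c4 u≡v))

mainTheorem8 : Σ ℕ λ C →
    (n m : ℕ) (ends : Fin m → Fin n × Fin n) → IsSimple n m ends →
    (intL : Fin m → Fin 8 → Fin 5 → ColList) →
    Construction.GadgetsForbidding ends intL →
    (γ : V' n m → Colour) →
    IsLColoring (Construction.Adj ends intL) (Construction.L ends intL) γ →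
    (e : Fin m) →
    (γ (orig (Construction.src ends intL e)) ≡ γ (orig (Construction.tgt ends intL e)) →
       γ (zv e) ≡ c4)
    ×
    (γ (orig (Construction.src ends intL e)) ≢ γ (orig (Construction.tgt ends intL e)) →
       Σ ℕ λ len → Σ (ℕ → V' n m → Colour) λ σ →
         len ≤ C
         × IsRecolSeq (Construction.Adj ends intL) (Construction.L ends intL) len σ
         × ((w : V' n m) → σ 0 w ≡ γ w)
         × σ len (zv e) ≢ c4
         × ((w : Fin n) → σ len (orig w) ≡ γ (orig w))
         × ((e' : Fin m) → e' ≢ e → σ len (zv e') ≡ γ (zv e')))
mainTheorem8 = 37 , λ n m ends _ intL forbidding γ γ-proper e →
  let open Gadget ends intL forbidding γ γ-proper e
  in equalEnds⇒z≡c4 , distinctEnds⇒zRecolourable
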